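{- Let $n\ge1$, $p$ a prime, and $m\ge1$. Then $Y_m\,\mathcal{R}(n,p)\subseteq Y_{m+1}$.
   Context: A composition of $n$ is a finite sequence $q=[a_1,\dots,a_s]$ of positive integers summing to $n$; $s$ is its number of components. For compositions $q=[a_1,\dots,a_s]$, $r=[b_1,\dots,b_t]$ of $n$, let $S(q,r)$ be the set of $s\times t$ matrices with non-negative integer entries whose $i$-th row sum is $a_i$ and $j$-th column sum is $b_j$. Let $\mathcal{Z}_n$ be the free $\mathbb{Z}$-module with basis $\{B_q\}$ indexed by compositions of $n$, with product $B_qB_r=\sum_{Z\in S(q,r)} B_{c(Z)}$, where $c(Z)$ is the composition obtained by reading the entries of $Z$ row by row and omitting zeros. $\Sigma(n,p)=\mathcal{Z}_n/p\mathcal{Z}_n$ over $\mathbb{F}_p$, with basis $\overline{B}_q$, and $\mathcal{R}(n,p)$ is its Jacobson radical. $Y_m$ is the $\mathbb{F}_p$-subspace of $\Sigma(n,p)$ spanned by all $\overline{B}_q$ with $q$ having $m$ or more components (so $Y_{n+1}=0$). -}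

module Defs where

open import Data.Nat as ℕ using (ℕ; zero; suc; _≤_; _⊓_; _∸_)
open import Data.Nat.Primality using (Prime) public
open import Data.Integer as ℤ using (ℤ; +_)
open import Data.Integer.Divisibility using () renaming (_∣_ to _∣ℤ_)
open import Data.List using (List; []; _∷_; map; concatMap; concat; filter; zipWith; length; upTo; _++_)
open import Data.Bool.ListAction using (and)
open import Data.Nat.ListAction using (sum)
open import Data.List.Relation.Unary.All using (All)
open import Data.List.Properties using (≡-dec)
open import Data.Product using (Σ; ∃; _×_; _,_; proj₁)
open import Data.Bool using (Bool; true; false; if_then_else_)
open import Relation.Nullary using (¬_; yes; no)
open import Relation.Binary.PropositionalEquality using (_≡_)

Composition : Set
Composition = List ℕ

IsComposition : ℕ → Composition → Set
IsComposition n q = All (λ a → 1 ≤ a) q × sum q ≡ n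

-- Enumeration of S(q,r): non-negative integer matrices (list of rows)
-- with row sums q and column sums r.

isZero : ℕ → Bool
isZero zero    = true
isZero (suc _) = false

vecs : ℕ → List ℕ → List (List ℕ)
vecs a []       = if isZero a then [] ∷ [] else []
vecs a (c ∷ cs) = concatMap (λ k → map (k ∷_) (vecs (a ∸ k) cs)) (upTo (suc (c ⊓ a)))

mats : List ℕ → List ℕ → List (List (List ℕ))
mats []       cs = if and (map isZero cs) then [] ∷ [] else []
mats (a ∷ as) cs = concatMap (λ v → map (v ∷_) (mats as (zipWith _∸_ cs v))) (vecs a cs)

readComp : List (List ℕ) → Composition
readComp Z = filter (λ k → 1 ℕ.≤? k) (concat Z)

-- Elements of Z_n as finite formal ℤ-linear combinations of basis
-- elements B_q, represented as lists of (q , coefficient).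

Comb : Set
Comb = List (Composition × ℤ)

IsElem : ℕ → Comb → Set
IsElem n x = All (λ t → IsComposition n (proj₁ t)) x

coeff : Comb → Composition → ℤ
coeff []            q = + 0
coeff ((q' , c) ∷ x) q with ≡-dec ℕ._≟_ q' q
... | yes _ = c ℤ.+ coeff x q
... | no  _ = coeff x q

-- equality in Σ(n,p) = Z_n / p Z_n : all coefficients agree mod p
_≈[_]_ : Comb → ℕ → Comb → Set
x ≈[ p ] y = ∀ (q : Composition) → (+ p) ∣ℤ (coeff x q ℤ.- coeff y q)

basisMul : Composition → Composition → Comb
basisMul q r = map (λ Z → readComp Z , + 1) (mats q r)

_*_ : Comb → Comb → Comb
x * y = concatMap (λ s → concatMap (λ t →
          map (λ u → proj₁ u , (Data.Product.proj₂ s ℤ.* Data.Product.proj₂ t)) (basisMul (proj₁ s) (proj₁ t))) y) x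
  where import Data.Product

_-_ : Comb → Comb → Comb
x - y = x ++ map (λ t → proj₁ t , ℤ.- Data.Product.proj₂ t) y
  where import Data.Product

one : ℕ → Comb
one n = (n ∷ [] , + 1) ∷ []

-- Jacobson radical R(n,p) of Σ(n,p):
-- x ∈ R iff for every a, 1 - a x is left invertible.
InRad : ℕ → ℕ → Comb → Set
InRad n p x = ∀ (a : Comb) → IsElem n a →
  ∃ λ (b : Comb) → IsElem n b × ((b * (one n - (a * x))) ≈[ p ] one n)

-- Y_m: F_p-span of the B_q with q having at least m components
InY : ℕ → ℕ → ℕ → Comb → Set
InY n p m x = ∃ λ (y : Comb) →
  All (λ t → IsComposition n (proj₁ t) × m ≤ length (proj₁ t)) y × (x ≈[ p ] y)

{-# OPTIONS --safe #-}
module Submission where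

-- For lists q and t, packings q t counts the ways to send each part of q to a position of
-- t so that every entry of t is the sum of the parts sent to it.  The linear extension
-- χ q of B_t ↦ packings q t is multiplicative: enumerating the matrices of S(s,t) row by
-- row, deducting the first part of q from one entry of a matrix amounts to deducting it
-- from one row sum and from one column sum.  Hence, for a prime p, χ q kills the Jacobson
-- radical modulo p.  On the other hand, if s has at least as many components as w, a
-- matrix Z ∈ S(s,t) has c(Z) = w only when w = s and every row of Z has a single non-zero
-- entry; those matrices are counted by packings s t.  So for y ∈ Y_m and w with at most m
-- components, the coefficient of B_w in y r is y_w · χ w r ≡ 0 (mod p).

open import Algebra.Bundles using (CommutativeSemiring)
open import Data.Bool using (Bool; true; false; if_then_else_; T)
open import Data.List using (List; []; _∷_; _++_; map; concatMap; concat; zipWith; upTo; filter; length)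
open import Data.List.Relation.Unary.All as All using (All; []; _∷_)

module ListSum {c ℓ} (R : CommutativeSemiring c ℓ) where

  open CommutativeSemiring R
  open import Algebra.Properties.CommutativeSemigroup +-commutativeSemigroup using (interchange)

  ∑ : {A : Set} → List A → (A → Carrier) → Carrier
  ∑ []       f = 0#
  ∑ (x ∷ xs) f = f x + ∑ xs f

  syntax ∑ xs (λ x → e) = ∑[ x ∈ xs ] e

  module _ {A : Set} where

    ∑-cong : (xs : List A) {f g : A → Carrier} → (∀ x → f x ≈ g x) → ∑ xs f ≈ ∑ xs g
    ∑-cong []       f≈g = refl
    ∑-cong (x ∷ xs) f≈g = +-cong (f≈g x) (∑-cong xs f≈g)

    ∑-congᴬ : {xs : List A} {f g : A → Carrier} → All (λ x → f x ≈ g x) xs → ∑ xs f ≈ ∑ xs g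
    ∑-congᴬ []           = refl
    ∑-congᴬ (fx≈gx ∷ eq) = +-cong fx≈gx (∑-congᴬ eq)

    ∑-++ : (xs ys : List A) (f : A → Carrier) → ∑ (xs ++ ys) f ≈ ∑ xs f + ∑ ys f
    ∑-++ []       ys f = sym (+-identityˡ _)
    ∑-++ (x ∷ xs) ys f = trans (+-cong refl (∑-++ xs ys f)) (sym (+-assoc _ _ _))

    ∑-zero : (xs : List A) → ∑[ x ∈ xs ] 0# ≈ 0#
    ∑-zero []       = refl
    ∑-zero (x ∷ xs) = trans (+-identityˡ _) (∑-zero xs)

    ∑-+ : (xs : List A) (f g : A → Carrier) → ∑[ x ∈ xs ] (f x + g x) ≈ ∑ xs f + ∑ xs g
    ∑-+ []       f g = sym (+-identityˡ 0#)
    ∑-+ (x ∷ xs) f g = trans (+-cong refl (∑-+ xs f g)) (interchange _ _ _ _)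

    ∑-*ˡ : (xs : List A) (a : Carrier) (f : A → Carrier) → ∑[ x ∈ xs ] (a * f x) ≈ a * ∑ xs f
    ∑-*ˡ []       a f = sym (zeroʳ a)
    ∑-*ˡ (x ∷ xs) a f = trans (+-cong refl (∑-*ˡ xs a f)) (sym (distribˡ a _ _))

    ∑-*ʳ : (xs : List A) (a : Carrier) (f : A → Carrier) → ∑[ x ∈ xs ] (f x * a) ≈ ∑ xs f * a
    ∑-*ʳ xs a f = trans (∑-cong xs (λ x → *-comm (f x) a)) (trans (∑-*ˡ xs a f) (*-comm a _))

    ∑-if : (xs : List A) (b : Bool) (f : A → Carrier) →
           ∑[ x ∈ xs ] (if b then f x else 0#) ≈ (if b then ∑ xs f else 0#)
    ∑-if xs true  f = refl
    ∑-if xs false f = ∑-zero xs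

    ∑-if-singleton : (b : Bool) (x : A) (f : A → Carrier) →
                     ∑ (if b then x ∷ [] else []) f ≈ (if b then f x else 0#)
    ∑-if-singleton true  x f = +-identityʳ (f x)
    ∑-if-singleton false x f = refl

  module _ {A B : Set} where

    ∑-map : (g : A → B) (xs : List A) (f : B → Carrier) → ∑ (map g xs) f ≈ ∑[ x ∈ xs ] f (g x)
    ∑-map g []       f = refl
    ∑-map g (x ∷ xs) f = +-cong refl (∑-map g xs f)

    ∑-concatMap : (g : A → List B) (xs : List A) (f : B → Carrier) →
                  ∑ (concatMap g xs) f ≈ ∑[ x ∈ xs ] ∑ (g x) f
    ∑-concatMap g []       f = refl
    ∑-concatMap g (x ∷ xs) f = trans (∑-++ (g x) (concat (map g xs)) f) (+-cong refl (∑-concatMap g xs f))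

    ∑-comm : (xs : List A) (ys : List B) (f : A → B → Carrier) →
             ∑[ x ∈ xs ] ∑ ys (f x) ≈ ∑[ y ∈ ys ] ∑[ x ∈ xs ] f x y
    ∑-comm []       ys f = sym (∑-zero ys)
    ∑-comm (x ∷ xs) ys f = trans (+-cong refl (∑-comm xs ys f)) (sym (∑-+ ys (f x) _))

    ∑-*-∑ : (xs : List A) (ys : List B) (f : A → Carrier) (g : B → Carrier) →
            ∑[ x ∈ xs ] ∑[ y ∈ ys ] (f x * g y) ≈ ∑ xs f * ∑ ys g
    ∑-*-∑ xs ys f g = trans (∑-cong xs (λ x → ∑-*ˡ ys (f x) g)) (∑-*ʳ xs (∑ ys g) f)

module Packings where

  open import Data.Bool.ListAction using (and)
  open import Data.Bool.Properties using (if-eta; if-cong; if-cong-then)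
  open import Data.Empty using (⊥-elim)
  open import Data.List.Properties using (map-applyUpTo; filter-++; ++-assoc; length-++; length-map; ≡-dec; ∷-injective; ∷-injectiveʳ)
  open import Data.List.Relation.Unary.All.Properties using (all-upTo; concat⁺; map⁺)
  open import Data.Nat using (ℕ; zero; suc; _+_; _*_; _∸_; _⊓_; _≤_; _<_; _≤ᵇ_; _<ᵇ_; z≤n; s≤s; _≟_)
  open import Data.Nat.ListAction using (sum)
  import Data.Nat.Properties as ℕₚ
  open import Data.Product using (_×_; _,_; proj₁; proj₂)
  open import Function using (id; _∘_)
  open import Relation.Binary.PropositionalEquality
  open import Relation.Nullary using (yes; no; does; ¬_)
  open import Relation.Nullary.Reflects using (ofʸ; ofⁿ; det; fromEquivalence)

  open import Defs using (vecs; mats; isZero; readComp)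

  open ListSum ℕₚ.+-*-commutativeSemiring public
  open ≡-Reasoning

  _⊖_ : List ℕ → List ℕ → List ℕ
  _⊖_ = zipWith _∸_

  deduct : ℕ → List ℕ → List (List ℕ)
  deduct b []       = []
  deduct b (c ∷ cs) = (if b ≤ᵇ c then ((c ∸ b) ∷ cs) ∷ [] else []) ++ map (c ∷_) (deduct b cs)

  deductᴹ : ℕ → List (List ℕ) → List (List (List ℕ))
  deductᴹ b []      = []
  deductᴹ b (v ∷ Z) = map (_∷ Z) (deduct b v) ++ map (v ∷_) (deductᴹ b Z)

  allZero : List ℕ → ℕ
  allZero []          = 1
  allZero (zero ∷ t)  = allZero t
  allZero (suc _ ∷ t) = 0

  packings : List ℕ → List ℕ → ℕ
  packings []      t = allZero t
  packings (a ∷ q) t = ∑ (deduct a t) (packings q)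

  ∑-upTo-suc : ∀ n (h : ℕ → ℕ) → ∑ (upTo (suc n)) h ≡ h 0 + ∑[ k ∈ upTo n ] h (suc k)
  ∑-upTo-suc n h = cong (h 0 +_) (trans (cong (λ ks → ∑ ks h) (sym (map-applyUpTo id suc n))) (∑-map suc (upTo n) h))

  ∑-upTo-cong : ∀ n {f g : ℕ → ℕ} → (∀ {k} → k < n → f k ≡ g k) → ∑ (upTo n) f ≡ ∑ (upTo n) g
  ∑-upTo-cong n f≡g = ∑-congᴬ (All.map f≡g (all-upTo n))

  ∑-upTo-resp : ∀ {m n} {h : ℕ → ℕ} → m ≡ n → ∑ (upTo m) h ≡ ∑ (upTo n) h
  ∑-upTo-resp {h = h} = cong (λ n → ∑ (upTo n) h)

  ∑-upTo-<ᵇ : ∀ n m (h : ℕ → ℕ) → ∑[ k ∈ upTo n ] (if k <ᵇ m then h k else 0) ≡ ∑ (upTo (n ⊓ m)) h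
  ∑-upTo-<ᵇ zero    m       h = refl
  ∑-upTo-<ᵇ (suc n) zero    h = trans (∑-upTo-suc n (λ k → if k <ᵇ 0 then h k else 0)) (∑-zero (upTo n))
  ∑-upTo-<ᵇ (suc n) (suc m) h = begin
    ∑[ k ∈ upTo (suc n) ] (if k <ᵇ suc m then h k else 0)   ≡⟨ ∑-upTo-suc n _ ⟩
    h 0 + ∑[ k ∈ upTo n ] (if k <ᵇ m then h (suc k) else 0)  ≡⟨ cong (h 0 +_) (∑-upTo-<ᵇ n m (h ∘ suc)) ⟩
    h 0 + ∑[ k ∈ upTo (n ⊓ m) ] h (suc k)                    ≡⟨ ∑-upTo-suc (n ⊓ m) h ⟨
    ∑ (upTo (suc (n ⊓ m))) h                                 ∎

  <ᵇ-suc : ∀ b k → (b <ᵇ suc k) ≡ (b ≤ᵇ k)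
  <ᵇ-suc zero    k = refl
  <ᵇ-suc (suc b) k = refl

  ∑-upTo-≤ᵇ : ∀ b N (h : ℕ → ℕ) → ∑[ k ∈ upTo (suc N) ] (if b ≤ᵇ k then h k else 0) ≡
              (if b ≤ᵇ N then ∑[ j ∈ upTo (suc (N ∸ b)) ] h (b + j) else 0)
  ∑-upTo-≤ᵇ zero    N       h = refl
  ∑-upTo-≤ᵇ (suc b) zero    h = refl
  ∑-upTo-≤ᵇ (suc b) (suc N) h = begin
      ∑[ k ∈ upTo (suc (suc N)) ] (if suc b ≤ᵇ k then h k else 0)
    ≡⟨ ∑-upTo-suc (suc N) (λ k → if suc b ≤ᵇ k then h k else 0) ⟩
      ∑[ k ∈ upTo (suc N) ] (if b <ᵇ suc k then h (suc k) else 0)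
    ≡⟨ ∑-cong (upTo (suc N)) (λ k → if-cong (<ᵇ-suc b k)) ⟩
      ∑[ k ∈ upTo (suc N) ] (if b ≤ᵇ k then h (suc k) else 0)
    ≡⟨ ∑-upTo-≤ᵇ b N (h ∘ suc) ⟩
      (if b ≤ᵇ N then ∑[ j ∈ upTo (suc (N ∸ b)) ] h (suc b + j) else 0)
    ≡⟨ if-cong (<ᵇ-suc b N) ⟨
      (if suc b ≤ᵇ suc N then ∑[ j ∈ upTo (suc (N ∸ b)) ] h (suc b + j) else 0)
    ∎

  ≤ᵇ-≡ : ∀ {a b c d} → (a ≤ b → c ≤ d) → (c ≤ d → a ≤ b) → (a ≤ᵇ b) ≡ (c ≤ᵇ d)
  ≤ᵇ-≡ {a} {b} {c} {d} f g =
    det (ℕₚ.≤ᵇ-reflects-≤ a b) (fromEquivalence (g ∘ ℕₚ.≤ᵇ⇒≤ c d) (ℕₚ.≤⇒≤ᵇ ∘ f))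

  ≤ᵇ-true : ∀ {b c} → b ≤ c → (b ≤ᵇ c) ≡ true
  ≤ᵇ-true {b} {c} b≤c = det (ℕₚ.≤ᵇ-reflects-≤ b c) (ofʸ b≤c)

  ≤ᵇ-false : ∀ {b c} → c < b → (b ≤ᵇ c) ≡ false
  ≤ᵇ-false {b} {c} c<b = det (ℕₚ.≤ᵇ-reflects-≤ b c) (ofⁿ (ℕₚ.<⇒≱ c<b))

  ≤∸-swap : ∀ {b c k} → k ≤ c → b ≤ c ∸ k → k ≤ c ∸ b
  ≤∸-swap {b} {c} {k} k≤c b≤c∸k =
    ℕₚ.m+n≤o⇒m≤o∸n k (subst (_≤ c) (ℕₚ.+-comm b k) (ℕₚ.m≤o∸n⇒m+n≤o b k≤c b≤c∸k))

  ≤ᵇ-∸-swap : ∀ {b c k} → b ≤ c → k ≤ c → (b ≤ᵇ c ∸ k) ≡ (k <ᵇ suc (c ∸ b))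
  ≤ᵇ-∸-swap b≤c k≤c = ≤ᵇ-≡ (s≤s ∘ ≤∸-swap k≤c) (≤∸-swap b≤c ∘ ℕₚ.≤-pred)

  ≤ᵇ-∸-false : ∀ {b c} k → c < b → (b ≤ᵇ c ∸ k) ≡ false
  ≤ᵇ-∸-false {c = c} k c<b = ≤ᵇ-false (ℕₚ.≤-<-trans (ℕₚ.m∸n≤m c k) c<b)

  ∸-comm : ∀ c k b → c ∸ k ∸ b ≡ c ∸ b ∸ k
  ∸-comm c k b = trans (ℕₚ.∸-+-assoc c k b) (trans (cong (c ∸_) (ℕₚ.+-comm k b)) (sym (ℕₚ.∸-+-assoc c b k)))

  c⊓a⊓[c∸b]≡[c∸b]⊓a : ∀ c a b → c ⊓ a ⊓ (c ∸ b) ≡ (c ∸ b) ⊓ a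
  c⊓a⊓[c∸b]≡[c∸b]⊓a c a b = trans (cong (_⊓ (c ∸ b)) (ℕₚ.⊓-comm c a)) (trans (ℕₚ.⊓-assoc a c (c ∸ b))
    (trans (cong (a ⊓_) (ℕₚ.m≥n⇒m⊓n≡n (ℕₚ.m∸n≤m c b))) (ℕₚ.⊓-comm a (c ∸ b))))

  c⊓a⊓[a∸b]≡c⊓[a∸b] : ∀ c a b → c ⊓ a ⊓ (a ∸ b) ≡ c ⊓ (a ∸ b)
  c⊓a⊓[a∸b]≡c⊓[a∸b] c a b =
    trans (ℕₚ.⊓-assoc c a (a ∸ b)) (cong (c ⊓_) (ℕₚ.m≥n⇒m⊓n≡n (ℕₚ.m∸n≤m a b)))

  ∑-vecs-cons : ∀ a c cs (f : List ℕ → ℕ) →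
    ∑ (vecs a (c ∷ cs)) f ≡ ∑[ k ∈ upTo (suc (c ⊓ a)) ] ∑[ w ∈ vecs (a ∸ k) cs ] f (k ∷ w)
  ∑-vecs-cons a c cs f = trans (∑-concatMap (λ k → map (k ∷_) (vecs (a ∸ k) cs)) (upTo (suc (c ⊓ a))) f)
    (∑-cong (upTo (suc (c ⊓ a))) (λ k → ∑-map (k ∷_) (vecs (a ∸ k) cs) f))

  ∑-mats-nil : ∀ t (f : List (List ℕ) → ℕ) → ∑ (mats [] t) f ≡ (if and (map isZero t) then f [] else 0)
  ∑-mats-nil t f = ∑-if-singleton _ [] f

  ∑-mats-cons : ∀ a s t (f : List (List ℕ) → ℕ) →
    ∑ (mats (a ∷ s) t) f ≡ ∑[ v ∈ vecs a t ] ∑[ Z ∈ mats s (t ⊖ v) ] f (v ∷ Z)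
  ∑-mats-cons a s t f = trans (∑-concatMap (λ v → map (v ∷_) (mats s (t ⊖ v))) (vecs a t) f)
    (∑-cong (vecs a t) (λ v → ∑-map (v ∷_) (mats s (t ⊖ v)) f))

  ∑-deduct-cons : ∀ b c cs (f : List ℕ → ℕ) →
    ∑ (deduct b (c ∷ cs)) f ≡ (if b ≤ᵇ c then f ((c ∸ b) ∷ cs) else 0) + ∑[ x ∈ deduct b cs ] f (c ∷ x)
  ∑-deduct-cons b c cs f = trans (∑-++ (if b ≤ᵇ c then ((c ∸ b) ∷ cs) ∷ [] else []) _ f)
    (cong₂ _+_ (∑-if-singleton (b ≤ᵇ c) _ f) (∑-map (c ∷_) (deduct b cs) f))

  ∑-deductᴹ-cons : ∀ b v Z (f : List (List ℕ) → ℕ) →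
    ∑ (deductᴹ b (v ∷ Z)) f ≡ ∑[ v' ∈ deduct b v ] f (v' ∷ Z) + ∑[ Z' ∈ deductᴹ b Z ] f (v ∷ Z')
  ∑-deductᴹ-cons b v Z f = trans (∑-++ (map (_∷ Z) (deduct b v)) _ f)
    (cong₂ _+_ (∑-map (_∷ Z) (deduct b v) f) (∑-map (v ∷_) (deductᴹ b Z) f))

  ∑-upTo-deduct-∸ : ∀ n b c (H : ℕ → ℕ → ℕ) → n ≤ c →
    ∑[ k ∈ upTo (suc n) ] (if b ≤ᵇ c ∸ k then H k (c ∸ k ∸ b) else 0) ≡
    (if b ≤ᵇ c then ∑[ k ∈ upTo (suc (n ⊓ (c ∸ b))) ] H k (c ∸ b ∸ k) else 0)
  ∑-upTo-deduct-∸ n b c H n≤c with b ℕₚ.≤? c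
  ... | yes b≤c = begin
    ∑[ k ∈ upTo (suc n) ] (if b ≤ᵇ c ∸ k then H k (c ∸ k ∸ b) else 0)       ≡⟨ ∑-upTo-cong (suc n) swap ⟩
    ∑[ k ∈ upTo (suc n) ] (if k <ᵇ suc (c ∸ b) then H k (c ∸ b ∸ k) else 0)  ≡⟨ ∑-upTo-<ᵇ (suc n) (suc (c ∸ b)) _ ⟩
    ∑[ k ∈ upTo (suc (n ⊓ (c ∸ b))) ] H k (c ∸ b ∸ k)                       ≡⟨ if-cong (≤ᵇ-true b≤c) ⟨
    (if b ≤ᵇ c then ∑[ k ∈ upTo (suc (n ⊓ (c ∸ b))) ] H k (c ∸ b ∸ k) else 0) ∎
    where
    swap : ∀ {k} → k < suc n →
           (if b ≤ᵇ c ∸ k then H k (c ∸ k ∸ b) else 0) ≡ (if k <ᵇ suc (c ∸ b) then H k (c ∸ b ∸ k) else 0)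
    swap {k} (s≤s k≤n) =
      cong₂ (λ β x → if β then H k x else 0) (≤ᵇ-∸-swap b≤c (ℕₚ.≤-trans k≤n n≤c)) (∸-comm c k b)
  ... | no b≰c = begin
    ∑[ k ∈ upTo (suc n) ] (if b ≤ᵇ c ∸ k then H k (c ∸ k ∸ b) else 0)       ≡⟨ ∑-cong (upTo (suc n)) vanish ⟩
    ∑[ k ∈ upTo (suc n) ] 0                                                  ≡⟨ ∑-zero (upTo (suc n)) ⟩
    0                                                                        ≡⟨ if-cong (≤ᵇ-false (ℕₚ.≰⇒> b≰c)) ⟨
    (if b ≤ᵇ c then ∑[ k ∈ upTo (suc (n ⊓ (c ∸ b))) ] H k (c ∸ b ∸ k) else 0) ∎
    where
    vanish : ∀ k → (if b ≤ᵇ c ∸ k then H k (c ∸ k ∸ b) else 0) ≡ 0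
    vanish k = if-cong (≤ᵇ-∸-false k (ℕₚ.≰⇒> b≰c))

  ∑-upTo-deduct-entry : ∀ a b c (H : ℕ → ℕ → ℕ → ℕ) →
    ∑[ k ∈ upTo (suc (c ⊓ a)) ] (if b ≤ᵇ k then H (k ∸ b) (c ∸ k) (a ∸ k) else 0) ≡
    (if b ≤ᵇ a then (if b ≤ᵇ c then ∑[ j ∈ upTo (suc ((c ∸ b) ⊓ (a ∸ b))) ] H j (c ∸ b ∸ j) (a ∸ b ∸ j) else 0) else 0)
  ∑-upTo-deduct-entry a b c H with b ℕₚ.≤? a
  ... | yes b≤a = begin
    ∑[ k ∈ upTo (suc (c ⊓ a)) ] (if b ≤ᵇ k then H (k ∸ b) (c ∸ k) (a ∸ k) else 0)
      ≡⟨ ∑-upTo-≤ᵇ b (c ⊓ a) _ ⟩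
    (if b ≤ᵇ c ⊓ a then ∑[ j ∈ upTo (suc (c ⊓ a ∸ b)) ] H (b + j ∸ b) (c ∸ (b + j)) (a ∸ (b + j)) else 0)
      ≡⟨ if-cong (≤ᵇ-≡ (λ b≤c⊓a → ℕₚ.≤-trans b≤c⊓a (ℕₚ.m⊓n≤m c a)) (λ b≤c → ℕₚ.⊓-glb b≤c b≤a)) ⟩
    (if b ≤ᵇ c then ∑[ j ∈ upTo (suc (c ⊓ a ∸ b)) ] H (b + j ∸ b) (c ∸ (b + j)) (a ∸ (b + j)) else 0)
      ≡⟨ if-cong-then (b ≤ᵇ c) (trans (∑-upTo-resp (cong suc (ℕₚ.∸-distribʳ-⊓ b c a)))
                                      (∑-cong (upTo (suc ((c ∸ b) ⊓ (a ∸ b)))) reindex)) ⟩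
    (if b ≤ᵇ c then ∑[ j ∈ upTo (suc ((c ∸ b) ⊓ (a ∸ b))) ] H j (c ∸ b ∸ j) (a ∸ b ∸ j) else 0)
      ≡⟨ if-cong (≤ᵇ-true b≤a) ⟨
    (if b ≤ᵇ a then (if b ≤ᵇ c then ∑[ j ∈ upTo (suc ((c ∸ b) ⊓ (a ∸ b))) ] H j (c ∸ b ∸ j) (a ∸ b ∸ j) else 0) else 0)
      ∎
    where
    reindex : ∀ j → H (b + j ∸ b) (c ∸ (b + j)) (a ∸ (b + j)) ≡ H j (c ∸ b ∸ j) (a ∸ b ∸ j)
    reindex j rewrite ℕₚ.m+n∸m≡n b j | ℕₚ.∸-+-assoc c b j | ℕₚ.∸-+-assoc a b j = refl
  ... | no b≰a = trans (∑-upTo-≤ᵇ b (c ⊓ a) _)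
    (trans (if-cong (≤ᵇ-false (ℕₚ.≤-<-trans (ℕₚ.m⊓n≤n c a) a<b))) (sym (if-cong (≤ᵇ-false a<b))))
    where a<b = ℕₚ.≰⇒> b≰a

  ∑-vecs-deduct-rest : ∀ a b t (ψ : List ℕ → List ℕ → ℕ) →
    ∑[ v ∈ vecs a t ] ∑ (deduct b (t ⊖ v)) (ψ v) ≡ ∑[ t' ∈ deduct b t ] ∑[ v ∈ vecs a t' ] ψ v (t' ⊖ v)
  ∑-vecs-deduct-rest a b []       ψ = ∑-zero (vecs a [])
  ∑-vecs-deduct-rest a b (c ∷ cs) ψ = begin
      ∑[ v ∈ vecs a (c ∷ cs) ] ∑ (deduct b ((c ∷ cs) ⊖ v)) (ψ v)
    ≡⟨ ∑-vecs-cons a c cs _ ⟩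
      ∑[ k ∈ ks ] ∑[ w ∈ vecs (a ∸ k) cs ] ∑ (deduct b ((c ∸ k) ∷ (cs ⊖ w))) (ψ (k ∷ w))
    ≡⟨ ∑-cong ks (λ k → trans (∑-cong (vecs (a ∸ k) cs) (λ w → ∑-deduct-cons b (c ∸ k) (cs ⊖ w) (ψ (k ∷ w))))
                               (∑-+ (vecs (a ∸ k) cs) _ _)) ⟩
      ∑[ k ∈ ks ] (fromFirst k + fromLater k)
    ≡⟨ ∑-+ ks fromFirst fromLater ⟩
      ∑ ks fromFirst + ∑ ks fromLater
    ≡⟨ cong₂ _+_ first-sum later-sum ⟩
      (if b ≤ᵇ c then ∑[ v ∈ vecs a ((c ∸ b) ∷ cs) ] ψ v (((c ∸ b) ∷ cs) ⊖ v) else 0)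
        + ∑[ x ∈ deduct b cs ] ∑[ v ∈ vecs a (c ∷ x) ] ψ v ((c ∷ x) ⊖ v)
    ≡⟨ ∑-deduct-cons b c cs (λ t' → ∑[ v ∈ vecs a t' ] ψ v (t' ⊖ v)) ⟨
      ∑[ t' ∈ deduct b (c ∷ cs) ] ∑[ v ∈ vecs a t' ] ψ v (t' ⊖ v)
    ∎
    where
    ks : List ℕ
    ks = upTo (suc (c ⊓ a))
    fromFirst fromLater : ℕ → ℕ
    fromFirst k = ∑[ w ∈ vecs (a ∸ k) cs ] (if b ≤ᵇ c ∸ k then ψ (k ∷ w) ((c ∸ k ∸ b) ∷ (cs ⊖ w)) else 0)
    fromLater k = ∑[ w ∈ vecs (a ∸ k) cs ] ∑[ x ∈ deduct b (cs ⊖ w) ] ψ (k ∷ w) ((c ∸ k) ∷ x)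
    first-sum : ∑ ks fromFirst ≡ (if b ≤ᵇ c then ∑[ v ∈ vecs a ((c ∸ b) ∷ cs) ] ψ v (((c ∸ b) ∷ cs) ⊖ v) else 0)
    first-sum = trans (∑-cong ks (λ k → ∑-if (vecs (a ∸ k) cs) (b ≤ᵇ c ∸ k) _))
      (trans (∑-upTo-deduct-∸ (c ⊓ a) b c (λ k d → ∑[ w ∈ vecs (a ∸ k) cs ] ψ (k ∷ w) (d ∷ (cs ⊖ w)))
                              (ℕₚ.m⊓n≤m c a))
        (if-cong-then (b ≤ᵇ c) (trans (∑-upTo-resp (cong suc (c⊓a⊓[c∸b]≡[c∸b]⊓a c a b)))
                                      (sym (∑-vecs-cons a (c ∸ b) cs _)))))
    later-sum : ∑ ks fromLater ≡ ∑[ x ∈ deduct b cs ] ∑[ v ∈ vecs a (c ∷ x) ] ψ v ((c ∷ x) ⊖ v)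
    later-sum = trans (∑-cong ks (λ k → ∑-vecs-deduct-rest (a ∸ k) b cs (λ w x → ψ (k ∷ w) ((c ∸ k) ∷ x))))
      (trans (∑-comm ks (deduct b cs) _) (∑-cong (deduct b cs) (λ x → sym (∑-vecs-cons a c x _))))

  if-+ : ∀ β {x y : ℕ} → (if β then x else 0) + (if β then y else 0) ≡ (if β then x + y else 0)
  if-+ true  = refl
  if-+ false = refl

  ∑-vecs-deduct : ∀ a b t (ψ : List ℕ → List ℕ → ℕ) →
    ∑[ v ∈ vecs a t ] ∑[ v' ∈ deduct b v ] ψ v' (t ⊖ v) ≡
    (if b ≤ᵇ a then ∑[ t' ∈ deduct b t ] ∑[ v' ∈ vecs (a ∸ b) t' ] ψ v' (t' ⊖ v') else 0)
  ∑-vecs-deduct zero    b []       ψ = sym (if-eta (b ≤ᵇ 0))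
  ∑-vecs-deduct (suc a) b []       ψ = sym (if-eta (b ≤ᵇ suc a))
  ∑-vecs-deduct a       b (c ∷ cs) ψ = begin
      ∑[ v ∈ vecs a (c ∷ cs) ] ∑[ v' ∈ deduct b v ] ψ v' ((c ∷ cs) ⊖ v)
    ≡⟨ ∑-vecs-cons a c cs _ ⟩
      ∑[ k ∈ ks ] ∑[ w ∈ vecs (a ∸ k) cs ] ∑[ v' ∈ deduct b (k ∷ w) ] ψ v' ((c ∸ k) ∷ (cs ⊖ w))
    ≡⟨ ∑-cong ks split ⟩
      ∑[ k ∈ ks ] (fromFirst k + fromLater k)
    ≡⟨ ∑-+ ks fromFirst fromLater ⟩
      ∑ ks fromFirst + ∑ ks fromLater
    ≡⟨ cong₂ _+_ first-sum later-sum ⟩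
      (if b ≤ᵇ a then (if b ≤ᵇ c then R ((c ∸ b) ∷ cs) else 0) else 0)
        + (if b ≤ᵇ a then ∑[ x ∈ deduct b cs ] R (c ∷ x) else 0)
    ≡⟨ if-+ (b ≤ᵇ a) ⟩
      (if b ≤ᵇ a then (if b ≤ᵇ c then R ((c ∸ b) ∷ cs) else 0) + ∑[ x ∈ deduct b cs ] R (c ∷ x) else 0)
    ≡⟨ if-cong-then (b ≤ᵇ a) (∑-deduct-cons b c cs R) ⟨
      (if b ≤ᵇ a then ∑ (deduct b (c ∷ cs)) R else 0)
    ∎
    where
    ks : List ℕ
    ks = upTo (suc (c ⊓ a))
    R : List ℕ → ℕ
    R t' = ∑[ v' ∈ vecs (a ∸ b) t' ] ψ v' (t' ⊖ v')
    G : ℕ → ℕ → ℕ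
    G k e = ∑[ t' ∈ deduct b cs ] ∑[ x ∈ vecs e t' ] ψ (k ∷ x) ((c ∸ k) ∷ (t' ⊖ x))
    fromFirst fromLater : ℕ → ℕ
    fromFirst k = if b ≤ᵇ k then ∑[ w ∈ vecs (a ∸ k) cs ] ψ ((k ∸ b) ∷ w) ((c ∸ k) ∷ (cs ⊖ w)) else 0
    fromLater k = if b ≤ᵇ a ∸ k then G k (a ∸ k ∸ b) else 0
    split : ∀ k → ∑[ w ∈ vecs (a ∸ k) cs ] ∑[ v' ∈ deduct b (k ∷ w) ] ψ v' ((c ∸ k) ∷ (cs ⊖ w)) ≡
                  fromFirst k + fromLater k
    split k = trans (∑-cong (vecs (a ∸ k) cs) (λ w → ∑-deduct-cons b k w _))
      (trans (∑-+ (vecs (a ∸ k) cs) _ _)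
        (cong₂ _+_ (∑-if (vecs (a ∸ k) cs) (b ≤ᵇ k) _)
                   (∑-vecs-deduct (a ∸ k) b cs (λ x y → ψ (k ∷ x) ((c ∸ k) ∷ y)))))
    first-sum : ∑ ks fromFirst ≡ (if b ≤ᵇ a then (if b ≤ᵇ c then R ((c ∸ b) ∷ cs) else 0) else 0)
    first-sum = trans (∑-upTo-deduct-entry a b c (λ j d e → ∑[ w ∈ vecs e cs ] ψ (j ∷ w) (d ∷ (cs ⊖ w))))
      (if-cong-then (b ≤ᵇ a) (if-cong-then (b ≤ᵇ c) (sym (∑-vecs-cons (a ∸ b) (c ∸ b) cs _))))
    later-sum : ∑ ks fromLater ≡ (if b ≤ᵇ a then ∑[ x ∈ deduct b cs ] R (c ∷ x) else 0)
    later-sum = trans (∑-upTo-deduct-∸ (c ⊓ a) b a G (ℕₚ.m⊓n≤n c a))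
      (if-cong-then (b ≤ᵇ a) (trans (∑-upTo-resp (cong suc (c⊓a⊓[a∸b]≡c⊓[a∸b] c a b)))
        (trans (∑-comm (upTo (suc (c ⊓ (a ∸ b)))) (deduct b cs) _)
          (∑-cong (deduct b cs) (λ x → sym (∑-vecs-cons (a ∸ b) c x _))))))

  ∑-mats-deductᴹ : ∀ b s t (φ : List (List ℕ) → ℕ) →
    ∑[ Z ∈ mats s t ] ∑ (deductᴹ b Z) φ ≡ ∑[ s' ∈ deduct b s ] ∑[ t' ∈ deduct b t ] ∑ (mats s' t') φ
  ∑-mats-deductᴹ b []      t φ = trans (∑-mats-nil t _) (if-eta (and (map isZero t)))
  ∑-mats-deductᴹ b (a ∷ s) t φ = begin
      ∑[ Z ∈ mats (a ∷ s) t ] ∑ (deductᴹ b Z) φ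
    ≡⟨ ∑-mats-cons a s t _ ⟩
      ∑[ v ∈ vecs a t ] ∑[ Z ∈ mats s (t ⊖ v) ] ∑ (deductᴹ b (v ∷ Z)) φ
    ≡⟨ ∑-cong (vecs a t) (λ v → trans (∑-cong (mats s (t ⊖ v)) (λ Z → ∑-deductᴹ-cons b v Z φ))
                                      (∑-+ (mats s (t ⊖ v)) _ _)) ⟩
      ∑[ v ∈ vecs a t ] (inRow v + inLaterRow v)
    ≡⟨ ∑-+ (vecs a t) inRow inLaterRow ⟩
      ∑ (vecs a t) inRow + ∑ (vecs a t) inLaterRow
    ≡⟨ cong₂ _+_ row-sum later-sum ⟩
      (if b ≤ᵇ a then R ((a ∸ b) ∷ s) else 0) + ∑[ x ∈ deduct b s ] R (a ∷ x)
    ≡⟨ ∑-deduct-cons b a s R ⟨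
      ∑ (deduct b (a ∷ s)) R
    ∎
    where
    R : List ℕ → ℕ
    R s' = ∑[ t' ∈ deduct b t ] ∑ (mats s' t') φ
    inRow inLaterRow : List ℕ → ℕ
    inRow      v = ∑[ Z ∈ mats s (t ⊖ v) ] ∑[ v' ∈ deduct b v ] φ (v' ∷ Z)
    inLaterRow v = ∑[ Z ∈ mats s (t ⊖ v) ] ∑[ Z' ∈ deductᴹ b Z ] φ (v ∷ Z')
    row-sum : ∑ (vecs a t) inRow ≡ (if b ≤ᵇ a then R ((a ∸ b) ∷ s) else 0)
    row-sum = trans (∑-cong (vecs a t) (λ v → ∑-comm (mats s (t ⊖ v)) (deduct b v) _))
      (trans (∑-vecs-deduct a b t (λ v' t' → ∑[ Z ∈ mats s t' ] φ (v' ∷ Z)))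
        (if-cong-then (b ≤ᵇ a) (∑-cong (deduct b t) (λ t' → sym (∑-mats-cons (a ∸ b) s t' φ)))))
    later-sum : ∑ (vecs a t) inLaterRow ≡ ∑[ x ∈ deduct b s ] R (a ∷ x)
    later-sum = trans (∑-cong (vecs a t) (λ v → ∑-mats-deductᴹ b s (t ⊖ v) (λ Z' → φ (v ∷ Z'))))
      (trans (∑-comm (vecs a t) (deduct b s) _)
        (∑-cong (deduct b s) (λ s' → trans (∑-vecs-deduct-rest a b t (λ v t' → ∑[ Z ∈ mats s' t' ] φ (v ∷ Z)))
          (∑-cong (deduct b t) (λ t' → sym (∑-mats-cons a s' t' φ))))))

  ∑-deduct-++ : ∀ b x y (f : List ℕ → ℕ) →
    ∑ (deduct b (x ++ y)) f ≡ ∑[ x' ∈ deduct b x ] f (x' ++ y) + ∑[ y' ∈ deduct b y ] f (x ++ y')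
  ∑-deduct-++ b []      y f = refl
  ∑-deduct-++ b (c ∷ x) y f = begin
      ∑ (deduct b (c ∷ x ++ y)) f
    ≡⟨ ∑-deduct-cons b c (x ++ y) f ⟩
      (if b ≤ᵇ c then f ((c ∸ b) ∷ x ++ y) else 0) + ∑[ z ∈ deduct b (x ++ y) ] f (c ∷ z)
    ≡⟨ cong₂ _+_ refl (∑-deduct-++ b x y (λ z → f (c ∷ z))) ⟩
      (if b ≤ᵇ c then f ((c ∸ b) ∷ x ++ y) else 0)
        + (∑[ x' ∈ deduct b x ] f (c ∷ x' ++ y) + ∑[ y' ∈ deduct b y ] f (c ∷ x ++ y'))
    ≡⟨ ℕₚ.+-assoc (if b ≤ᵇ c then f ((c ∸ b) ∷ x ++ y) else 0) (∑[ x' ∈ deduct b x ] f (c ∷ x' ++ y)) _ ⟨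
      (if b ≤ᵇ c then f ((c ∸ b) ∷ x ++ y) else 0) + ∑[ x' ∈ deduct b x ] f (c ∷ x' ++ y)
        + ∑[ y' ∈ deduct b y ] f (c ∷ x ++ y')
    ≡⟨ cong₂ _+_ (∑-deduct-cons b c x (λ x' → f (x' ++ y))) refl ⟨
      ∑[ x' ∈ deduct b (c ∷ x) ] f (x' ++ y) + ∑[ y' ∈ deduct b y ] f (c ∷ x ++ y')
    ∎

  ∑-deduct-concat : ∀ b Z (f : List ℕ → ℕ) → ∑ (deduct b (concat Z)) f ≡ ∑[ Z' ∈ deductᴹ b Z ] f (concat Z')
  ∑-deduct-concat b []      f = refl
  ∑-deduct-concat b (v ∷ Z) f = begin
      ∑ (deduct b (v ++ concat Z)) f
    ≡⟨ ∑-deduct-++ b v (concat Z) f ⟩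
      ∑[ v' ∈ deduct b v ] f (v' ++ concat Z) + ∑[ z ∈ deduct b (concat Z) ] f (v ++ z)
    ≡⟨ cong₂ _+_ refl (∑-deduct-concat b Z (λ z → f (v ++ z))) ⟩
      ∑[ v' ∈ deduct b v ] f (v' ++ concat Z) + ∑[ Z' ∈ deductᴹ b Z ] f (v ++ concat Z')
    ≡⟨ ∑-deductᴹ-cons b v Z (λ Z' → f (concat Z')) ⟨
      ∑[ Z' ∈ deductᴹ b (v ∷ Z) ] f (concat Z')
    ∎

  allZero-and : ∀ t → (if and (map isZero t) then 1 else 0) ≡ allZero t
  allZero-and []          = refl
  allZero-and (zero ∷ t)  = allZero-and t
  allZero-and (suc _ ∷ t) = refl

  allZero-++ : ∀ x y → allZero (x ++ y) ≡ allZero x * allZero y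
  allZero-++ []          y = sym (ℕₚ.+-identityʳ (allZero y))
  allZero-++ (zero ∷ x)  y = allZero-++ x y
  allZero-++ (suc _ ∷ x) y = refl

  ∑-vecs-allZero : ∀ a t (g : List ℕ → ℕ) → ∑[ v ∈ vecs a t ] (allZero v * g (t ⊖ v)) ≡ allZero (a ∷ []) * g t
  ∑-vecs-allZero zero    []       g = ℕₚ.+-identityʳ _
  ∑-vecs-allZero (suc a) []       g = refl
  ∑-vecs-allZero a       (c ∷ cs) g = begin
      ∑[ v ∈ vecs a (c ∷ cs) ] (allZero v * g ((c ∷ cs) ⊖ v))
    ≡⟨ trans (∑-vecs-cons a c cs _) (∑-upTo-suc (c ⊓ a) _) ⟩
      ∑[ w ∈ vecs a cs ] (allZero w * g (c ∷ (cs ⊖ w))) + ∑[ k ∈ upTo (c ⊓ a) ] ∑[ w ∈ vecs (a ∸ suc k) cs ] 0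
    ≡⟨ cong₂ _+_ refl (trans (∑-cong (upTo (c ⊓ a)) (λ k → ∑-zero (vecs (a ∸ suc k) cs))) (∑-zero (upTo (c ⊓ a)))) ⟩
      ∑[ w ∈ vecs a cs ] (allZero w * g (c ∷ (cs ⊖ w))) + 0
    ≡⟨ ℕₚ.+-identityʳ _ ⟩
      ∑[ w ∈ vecs a cs ] (allZero w * g (c ∷ (cs ⊖ w)))
    ≡⟨ ∑-vecs-allZero a cs (λ y → g (c ∷ y)) ⟩
      allZero (a ∷ []) * g (c ∷ cs)
    ∎

  ∑-mats-allZero : ∀ s t → ∑[ Z ∈ mats s t ] allZero (concat Z) ≡ allZero s * allZero t
  ∑-mats-allZero []      t = trans (∑-mats-nil t _) (trans (allZero-and t) (sym (ℕₚ.+-identityʳ (allZero t))))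
  ∑-mats-allZero (a ∷ s) t = begin
      ∑[ Z ∈ mats (a ∷ s) t ] allZero (concat Z)
    ≡⟨ ∑-mats-cons a s t _ ⟩
      ∑[ v ∈ vecs a t ] ∑[ Z ∈ mats s (t ⊖ v) ] allZero (v ++ concat Z)
    ≡⟨ ∑-cong (vecs a t) factor ⟩
      ∑[ v ∈ vecs a t ] (allZero v * (allZero s * allZero (t ⊖ v)))
    ≡⟨ ∑-vecs-allZero a t (λ y → allZero s * allZero y) ⟩
      allZero (a ∷ []) * (allZero s * allZero t)
    ≡⟨ ℕₚ.*-assoc (allZero (a ∷ [])) (allZero s) (allZero t) ⟨
      allZero (a ∷ []) * allZero s * allZero t
    ≡⟨ cong (_* allZero t) (allZero-++ (a ∷ []) s) ⟨
      allZero (a ∷ s) * allZero t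
    ∎
    where
    factor : ∀ v → ∑[ Z ∈ mats s (t ⊖ v) ] allZero (v ++ concat Z) ≡ allZero v * (allZero s * allZero (t ⊖ v))
    factor v = trans (∑-cong (mats s (t ⊖ v)) (λ Z → allZero-++ v (concat Z)))
      (trans (∑-*ˡ (mats s (t ⊖ v)) (allZero v) _) (cong (allZero v *_) (∑-mats-allZero s (t ⊖ v))))

  ∑-mats-packings : ∀ q s t → ∑[ Z ∈ mats s t ] packings q (concat Z) ≡ packings q s * packings q t
  ∑-mats-packings []      s t = ∑-mats-allZero s t
  ∑-mats-packings (b ∷ q) s t = begin
      ∑[ Z ∈ mats s t ] ∑ (deduct b (concat Z)) (packings q)
    ≡⟨ ∑-cong (mats s t) (λ Z → ∑-deduct-concat b Z (packings q)) ⟩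
      ∑[ Z ∈ mats s t ] ∑[ Z' ∈ deductᴹ b Z ] packings q (concat Z')
    ≡⟨ ∑-mats-deductᴹ b s t _ ⟩
      ∑[ s' ∈ deduct b s ] ∑[ t' ∈ deduct b t ] ∑[ Z ∈ mats s' t' ] packings q (concat Z)
    ≡⟨ ∑-cong (deduct b s) (λ s' → ∑-cong (deduct b t) (∑-mats-packings q s')) ⟩
      ∑[ s' ∈ deduct b s ] ∑[ t' ∈ deduct b t ] (packings q s' * packings q t')
    ≡⟨ ∑-*-∑ (deduct b s) (deduct b t) (packings q) (packings q) ⟩
      packings (b ∷ q) s * packings (b ∷ q) t
    ∎

  Positive : List ℕ → Set
  Positive = All (1 ≤_)

  positives : List ℕ → List ℕ
  positives = filter (1 ℕₚ.≤?_)

  packings-zero : ∀ q → Positive q → ∀ x y → packings q (x ++ 0 ∷ y) ≡ packings q (x ++ y)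
  packings-zero []          _          x y = trans (allZero-++ x (0 ∷ y)) (sym (allZero-++ x y))
  packings-zero (suc a ∷ q) (_ ∷ q⁺) x y = begin
      ∑ (deduct (suc a) (x ++ 0 ∷ y)) (packings q)
    ≡⟨ ∑-deduct-++ (suc a) x (0 ∷ y) (packings q) ⟩
      ∑[ x' ∈ deduct (suc a) x ] packings q (x' ++ 0 ∷ y) + ∑[ y' ∈ map (0 ∷_) (deduct (suc a) y) ] packings q (x ++ y')
    ≡⟨ cong₂ _+_ (∑-cong (deduct (suc a) x) (λ x' → packings-zero q q⁺ x' y))
                 (trans (∑-map (0 ∷_) (deduct (suc a) y) _) (∑-cong (deduct (suc a) y) (packings-zero q q⁺ x))) ⟩
      ∑[ x' ∈ deduct (suc a) x ] packings q (x' ++ y) + ∑[ y' ∈ deduct (suc a) y ] packings q (x ++ y')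
    ≡⟨ ∑-deduct-++ (suc a) x y (packings q) ⟨
      ∑ (deduct (suc a) (x ++ y)) (packings q)
    ∎

  packings-positives : ∀ q → Positive q → ∀ t → packings q (positives t) ≡ packings q t
  packings-positives q q⁺ t = sym (drop-zeros [] t)
    where
    drop-zeros : ∀ x y → packings q (x ++ y) ≡ packings q (x ++ positives y)
    drop-zeros x []          = refl
    drop-zeros x (zero ∷ y)  = trans (packings-zero q q⁺ x y) (drop-zeros x y)
    drop-zeros x (suc k ∷ y) = begin
      packings q (x ++ suc k ∷ y)                ≡⟨ cong (packings q) (++-assoc x (suc k ∷ []) y) ⟨
      packings q ((x ++ suc k ∷ []) ++ y)            ≡⟨ drop-zeros (x ++ suc k ∷ []) y ⟩
      packings q ((x ++ suc k ∷ []) ++ positives y)  ≡⟨ cong (packings q) (++-assoc x (suc k ∷ []) (positives y)) ⟩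
      packings q (x ++ suc k ∷ positives y)      ∎

  ∑-mats-packings-readComp : ∀ q → Positive q → ∀ s t →
    ∑[ Z ∈ mats s t ] packings q (readComp Z) ≡ packings q s * packings q t
  ∑-mats-packings-readComp q q⁺ s t =
    trans (∑-cong (mats s t) (λ Z → packings-positives q q⁺ (concat Z))) (∑-mats-packings q s t)

  sum-vecs : ∀ a t → All (λ v → sum v ≡ a) (vecs a t)
  sum-vecs zero    []       = refl ∷ []
  sum-vecs (suc a) []       = []
  sum-vecs a       (c ∷ cs) = concat⁺ (map⁺ (All.map prefix (all-upTo (suc (c ⊓ a)))))
    where
    prefix : ∀ {k} → k < suc (c ⊓ a) → All (λ v → sum v ≡ a) (map (k ∷_) (vecs (a ∸ k) cs))
    prefix {k} (s≤s k≤c⊓a) =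
      map⁺ (All.map (λ sum≡ → trans (cong (k +_) sum≡) (ℕₚ.m+[n∸m]≡n k≤a)) (sum-vecs (a ∸ k) cs))
      where k≤a = ℕₚ.≤-trans k≤c⊓a (ℕₚ.m⊓n≤n c a)

  rowSums-mats : ∀ s t → All (λ Z → map sum Z ≡ s) (mats s t)
  rowSums-mats []      t with and (map isZero t)
  ... | true  = refl ∷ []
  ... | false = []
  rowSums-mats (a ∷ s) t = concat⁺ (map⁺ (All.map (λ sum≡ → map⁺ (All.map (cong₂ _∷_ sum≡) (rowSums-mats s (t ⊖ _))))
                                                  (sum-vecs a t)))

  δ : List ℕ → List ℕ → ℕ
  δ x y = if does (≡-dec _≟_ x y) then 1 else 0

  δⁿ : ℕ → ℕ → ℕ
  δⁿ x y = if does (x ≟ y) then 1 else 0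

  δ-∷ : ∀ x xs y ys → δ (x ∷ xs) (y ∷ ys) ≡ δⁿ x y * δ xs ys
  δ-∷ x xs y ys with does (x ≟ y) | does (≡-dec _≟_ xs ys)
  ... | true  | true  = refl
  ... | true  | false = refl
  ... | false | _     = refl

  δ-≡ : ∀ {x y} → x ≡ y → δ x y ≡ 1
  δ-≡ {x} {y} x≡y with ≡-dec _≟_ x y
  ... | yes _   = refl
  ... | no  x≢y = ⊥-elim (x≢y x≡y)

  δ-≢ : ∀ {x y} → ¬ x ≡ y → δ x y ≡ 0
  δ-≢ {x} {y} x≢y with ≡-dec _≟_ x y
  ... | yes x≡y = ⊥-elim (x≢y x≡y)
  ... | no  _   = refl

  ∑-upTo-δⁿ : ∀ N a (X : ℕ → ℕ) → ∑[ k ∈ upTo N ] (δⁿ k a * X k) ≡ (if a <ᵇ N then X a else 0)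
  ∑-upTo-δⁿ zero    a       X = refl
  ∑-upTo-δⁿ (suc N) zero    X = trans (∑-upTo-suc N (λ k → δⁿ k 0 * X k))
    (trans (cong₂ _+_ (ℕₚ.+-identityʳ (X 0)) (∑-zero (upTo N))) (ℕₚ.+-identityʳ (X 0)))
  ∑-upTo-δⁿ (suc N) (suc a) X = trans (∑-upTo-suc N (λ k → δⁿ k (suc a) * X k)) (∑-upTo-δⁿ N a (X ∘ suc))

  sum-positives : ∀ v → sum (positives v) ≡ sum v
  sum-positives []          = refl
  sum-positives (zero ∷ v)  = sum-positives v
  sum-positives (suc k ∷ v) = cong (suc k +_) (sum-positives v)

  positives-nonempty : ∀ v → 1 ≤ sum v → 1 ≤ length (positives v)
  positives-nonempty v 1≤sum with positives v | sum-positives v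
  ... | []    | sum≡ = ⊥-elim (ℕₚ.<⇒≱ 1≤sum (ℕₚ.≤-reflexive (sym sum≡)))
  ... | _ ∷ _ | _    = s≤s z≤n

  readComp-∷ : ∀ v Z → readComp (v ∷ Z) ≡ positives v ++ readComp Z
  readComp-∷ v Z = filter-++ (1 ℕₚ.≤?_) v (concat Z)

  length-readComp : ∀ Z → Positive (map sum Z) → length Z ≤ length (readComp Z)
  length-readComp []      _           = z≤n
  length-readComp (v ∷ Z) (1≤v ∷ Z⁺) rewrite readComp-∷ v Z | length-++ (positives v) {readComp Z} =
    ℕₚ.+-mono-≤ (positives-nonempty v 1≤v) (length-readComp Z Z⁺)

  ++-≡-∷ : ∀ (u r : List ℕ) a s → 1 ≤ length u → length s ≤ length r → u ++ r ≡ a ∷ s → u ≡ a ∷ [] × r ≡ s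
  ++-≡-∷ (x ∷ [])    r a s _ _ eq = cong (_∷ []) (proj₁ (∷-injective eq)) , proj₂ (∷-injective eq)
  ++-≡-∷ (x ∷ y ∷ u) r a s _ s≤r eq = ⊥-elim (ℕₚ.<⇒≱ r<s s≤r)
    where
    r<s : length r < length s
    r<s = subst (length r <_) (trans (sym (length-++ (y ∷ u) {r})) (cong length (∷-injectiveʳ eq)))
                (s≤s (ℕₚ.m≤n+m (length r) (length u)))

  δ-++ : ∀ (u r : List ℕ) a s → 1 ≤ length u → length s ≤ length r →
         δ (u ++ r) (a ∷ s) ≡ δ u (a ∷ []) * δ r s
  δ-++ u r a s 1≤u s≤r with ≡-dec _≟_ (u ++ r) (a ∷ s)
  ... | yes eq = sym (cong₂ _*_ (δ-≡ (proj₁ split)) (δ-≡ (proj₂ split)))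
    where split = ++-≡-∷ u r a s 1≤u s≤r eq
  ... | no neq with ≡-dec _≟_ u (a ∷ []) | ≡-dec _≟_ r s
  ...   | yes u≡a | yes r≡s = ⊥-elim (neq (cong₂ _++_ u≡a r≡s))
  ...   | yes _   | no  _   = refl
  ...   | no  _   | _       = refl

  positives-singleton : ∀ v → length (positives v) ≤ 1 → 1 ≤ sum v → positives v ≡ sum v ∷ []
  positives-singleton v len≤1 1≤sum with positives v | sum-positives v
  ... | []        | sum≡ = ⊥-elim (ℕₚ.<⇒≱ 1≤sum (ℕₚ.≤-reflexive (sym sum≡)))
  ... | x ∷ []    | sum≡ = cong (_∷ []) (trans (sym (ℕₚ.+-identityʳ x)) sum≡)
  ... | _ ∷ _ ∷ _ | _    with len≤1
  ...   | s≤s ()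

  readComp-tight : ∀ Z → Positive (map sum Z) → length (readComp Z) ≤ length Z → readComp Z ≡ map sum Z
  readComp-tight []      _           _     = refl
  readComp-tight (v ∷ Z) (1≤v ∷ Z⁺) len≤ = begin
      readComp (v ∷ Z)           ≡⟨ readComp-∷ v Z ⟩
      positives v ++ readComp Z  ≡⟨ cong₂ _++_ (positives-singleton v v≤1 1≤v) (readComp-tight Z Z⁺ Z≤Z) ⟩
      sum v ∷ map sum Z          ∎
    where
    total : length (positives v) + length (readComp Z) ≤ suc (length Z)
    total = subst (_≤ suc (length Z)) (trans (cong length (readComp-∷ v Z)) (length-++ (positives v))) len≤
    Z≤Z : length (readComp Z) ≤ length Z
    Z≤Z = ℕₚ.≤-pred (ℕₚ.≤-trans (ℕₚ.+-monoˡ-≤ (length (readComp Z)) (positives-nonempty v 1≤v)) total)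
    v≤1 : length (positives v) ≤ 1
    v≤1 = ℕₚ.+-cancelʳ-≤ (length Z) (length (positives v)) 1
            (ℕₚ.≤-trans (ℕₚ.+-monoʳ-≤ (length (positives v)) (length-readComp Z Z⁺)) total)

  ∑-vecs-zero : ∀ cs (h : List ℕ → ℕ) → ∑[ w ∈ vecs 0 cs ] (δ (positives w) [] * h (cs ⊖ w)) ≡ h cs
  ∑-vecs-zero []       h = trans (ℕₚ.+-identityʳ _) (ℕₚ.*-identityˡ (h []))
  ∑-vecs-zero (c ∷ cs) h = begin
      ∑[ w ∈ vecs 0 (c ∷ cs) ] (δ (positives w) [] * h ((c ∷ cs) ⊖ w))
    ≡⟨ ∑-vecs-cons 0 c cs _ ⟩
      ∑[ k ∈ upTo (suc (c ⊓ 0)) ] ∑[ w ∈ vecs (0 ∸ k) cs ] (δ (positives (k ∷ w)) [] * h ((c ∸ k) ∷ (cs ⊖ w)))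
    ≡⟨ ∑-upTo-resp (cong suc (ℕₚ.⊓-zeroʳ c)) ⟩
      ∑[ w ∈ vecs 0 cs ] (δ (positives w) [] * h (c ∷ (cs ⊖ w))) + 0
    ≡⟨ trans (ℕₚ.+-identityʳ _) (∑-vecs-zero cs (λ y → h (c ∷ y))) ⟩
      h (c ∷ cs)
    ∎

  ∑-vecs-single-entry : ∀ a t (g : List ℕ → ℕ) →
    ∑[ v ∈ vecs (suc a) t ] (δ (positives v) (suc a ∷ []) * g (t ⊖ v)) ≡ ∑ (deduct (suc a) t) g
  ∑-vecs-single-entry a []       g = refl
  ∑-vecs-single-entry a (c ∷ cs) g = begin
      ∑[ v ∈ vecs (suc a) (c ∷ cs) ] (δ (positives v) (suc a ∷ []) * g ((c ∷ cs) ⊖ v))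
    ≡⟨ trans (∑-vecs-cons (suc a) c cs _) (∑-upTo-suc (c ⊓ suc a) _) ⟩
      ∑[ w ∈ vecs (suc a) cs ] (δ (positives w) (suc a ∷ []) * g (c ∷ (cs ⊖ w)))
        + ∑[ k ∈ upTo (c ⊓ suc a) ] X′ k
    ≡⟨ cong₂ _+_ (∑-vecs-single-entry a cs (λ y → g (c ∷ y))) firstEntry ⟩
      ∑[ y ∈ deduct (suc a) cs ] g (c ∷ y) + (if suc a ≤ᵇ c then g ((c ∸ suc a) ∷ cs) else 0)
    ≡⟨ trans (ℕₚ.+-comm (∑[ y ∈ deduct (suc a) cs ] g (c ∷ y)) _) (sym (∑-deduct-cons (suc a) c cs g)) ⟩
      ∑ (deduct (suc a) (c ∷ cs)) g
    ∎
    where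
    X′ X : ℕ → ℕ
    X′ k = ∑[ w ∈ vecs (a ∸ k) cs ] (δ (suc k ∷ positives w) (suc a ∷ []) * g ((c ∸ suc k) ∷ (cs ⊖ w)))
    X  k = ∑[ w ∈ vecs (a ∸ k) cs ] (δ (positives w) [] * g ((c ∸ suc k) ∷ (cs ⊖ w)))
    factor : ∀ k → X′ k ≡ δⁿ k a * X k
    factor k = trans (∑-cong (vecs (a ∸ k) cs) (λ w →
        trans (cong (_* g ((c ∸ suc k) ∷ (cs ⊖ w))) (δ-∷ (suc k) (positives w) (suc a) []))
              (ℕₚ.*-assoc (δⁿ k a) (δ (positives w) []) _)))
      (∑-*ˡ (vecs (a ∸ k) cs) (δⁿ k a) _)
    firstEntry : ∑ (upTo (c ⊓ suc a)) X′ ≡ (if suc a ≤ᵇ c then g ((c ∸ suc a) ∷ cs) else 0)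
    firstEntry = begin
      ∑ (upTo (c ⊓ suc a)) X′                          ≡⟨ ∑-cong (upTo (c ⊓ suc a)) factor ⟩
      ∑[ k ∈ upTo (c ⊓ suc a) ] (δⁿ k a * X k)          ≡⟨ ∑-upTo-δⁿ (c ⊓ suc a) a X ⟩
      (if a <ᵇ c ⊓ suc a then X a else 0)              ≡⟨ if-cong (≤ᵇ-≡ (λ le → ℕₚ.≤-trans le (ℕₚ.m⊓n≤m c (suc a)))
                                                                      (λ le → ℕₚ.⊓-glb le ℕₚ.≤-refl)) ⟩
      (if suc a ≤ᵇ c then X a else 0)                  ≡⟨ if-cong-then (suc a ≤ᵇ c) X[a] ⟩
      (if suc a ≤ᵇ c then g ((c ∸ suc a) ∷ cs) else 0) ∎
      where
      X[a] : X a ≡ g ((c ∸ suc a) ∷ cs)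
      X[a] rewrite ℕₚ.n∸n≡0 a = ∑-vecs-zero cs (λ y → g ((c ∸ suc a) ∷ y))

  ∑-mats-δ-rowSums : ∀ s → Positive s → ∀ t → ∑[ Z ∈ mats s t ] δ (readComp Z) s ≡ packings s t
  ∑-mats-δ-rowSums []          _          t = trans (∑-mats-nil t _) (allZero-and t)
  ∑-mats-δ-rowSums (suc a ∷ s) (_ ∷ s⁺) t = begin
      ∑[ Z ∈ mats (suc a ∷ s) t ] δ (readComp Z) (suc a ∷ s)
    ≡⟨ ∑-mats-cons (suc a) s t _ ⟩
      ∑[ v ∈ vecs (suc a) t ] ∑[ Z ∈ mats s (t ⊖ v) ] δ (readComp (v ∷ Z)) (suc a ∷ s)
    ≡⟨ ∑-congᴬ (All.map firstRow (sum-vecs (suc a) t)) ⟩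
      ∑[ v ∈ vecs (suc a) t ] (δ (positives v) (suc a ∷ []) * packings s (t ⊖ v))
    ≡⟨ ∑-vecs-single-entry a t (packings s) ⟩
      packings (suc a ∷ s) t
    ∎
    where
    split : ∀ v → sum v ≡ suc a → ∀ {Z} → map sum Z ≡ s →
            δ (readComp (v ∷ Z)) (suc a ∷ s) ≡ δ (positives v) (suc a ∷ []) * δ (readComp Z) s
    split v sum≡ {Z} rows≡ = trans (cong (λ x → δ x (suc a ∷ s)) (readComp-∷ v Z))
      (δ-++ (positives v) (readComp Z) (suc a) s (positives-nonempty v (subst (1 ≤_) (sym sum≡) (s≤s z≤n)))
        (subst (_≤ length (readComp Z)) (trans (sym (length-map sum Z)) (cong length rows≡))
          (length-readComp Z (subst Positive (sym rows≡) s⁺))))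
    firstRow : ∀ {v} → sum v ≡ suc a →
               ∑[ Z ∈ mats s (t ⊖ v) ] δ (readComp (v ∷ Z)) (suc a ∷ s) ≡ δ (positives v) (suc a ∷ []) * packings s (t ⊖ v)
    firstRow {v} sum≡ = trans (∑-congᴬ (All.map (split v sum≡) (rowSums-mats s (t ⊖ v))))
      (trans (∑-*ˡ (mats s (t ⊖ v)) (δ (positives v) (suc a ∷ [])) _)
        (cong (δ (positives v) (suc a ∷ []) *_) (∑-mats-δ-rowSums s s⁺ (t ⊖ v))))

  ∑-mats-δ : ∀ s → Positive s → ∀ t w → length w ≤ length s →
             ∑[ Z ∈ mats s t ] δ (readComp Z) w ≡ δ s w * packings s t
  ∑-mats-δ s s⁺ t w w≤s = trans (∑-congᴬ (All.map factor (rowSums-mats s t)))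
    (trans (∑-*ˡ (mats s t) (δ s w) _) (cong (δ s w *_) (∑-mats-δ-rowSums s s⁺ t)))
    where
    factor : ∀ {Z} → map sum Z ≡ s → δ (readComp Z) w ≡ δ s w * δ (readComp Z) s
    factor {Z} rows≡ with ≡-dec _≟_ (readComp Z) w
    ... | yes Z≡w = sym (cong₂ _*_ (δ-≡ (trans (sym Z≡s) Z≡w)) (δ-≡ Z≡s))
      where
      length≤ : length (readComp Z) ≤ length Z
      length≤ = subst₂ _≤_ (cong length (sym Z≡w)) (trans (cong length (sym rows≡)) (length-map sum Z)) w≤s
      Z≡s : readComp Z ≡ s
      Z≡s = trans (readComp-tight Z (subst Positive (sym rows≡) s⁺) length≤) rows≡
    ... | no Z≢w with ≡-dec _≟_ s w
    ...   | no  _   = refl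
    ...   | yes s≡w = sym (cong (1 *_) (δ-≢ (λ Z≡s → Z≢w (trans Z≡s s≡w))))

module Characters where

  open import Data.Bool.Properties using (if-eta; if-cong)
  open import Data.Empty using (⊥-elim)
  open import Data.Integer using (ℤ; +_; 0ℤ; 1ℤ; -1ℤ; -_; _+_; _*_; _-_; ∣_∣)
  open import Data.Integer.Divisibility.Signed using (_∣_; divides; ∣ᵤ⇒∣; ∣⇒∣ᵤ; ∣m∣n⇒∣m+n; ∣m∣n⇒∣m-n; ∣m⇒∣m*n; ∣n⇒∣m*n)
  import Data.Integer.Properties as ℤₚ
  open import Algebra.Properties.CommutativeSemigroup ℤₚ.*-commutativeSemigroup using (x∙yz≈y∙xz)
  open import Data.Integer.Tactic.RingSolver using (solve-∀)
  open import Data.List.Properties using (≡-dec)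
  open import Data.List.Relation.Unary.All.Properties using (all-filter; filter⁺; concat⁺; map⁺)
  open import Data.Nat as ℕ using (ℕ; suc; _≤_; _<ᵇ_; z≤n; s≤s)
  open import Data.Nat.Coprimality using (Coprime; coprime-Bézout)
  import Data.Nat.Divisibility as ℕ∣
  open import Data.Nat.GCD using (module Bézout)
  open import Data.Nat.ListAction using (sum)
  open import Data.Nat.ListAction.Properties using (sum-++)
  open import Data.Nat.Primality using (Prime; prime⇒irreducible; ¬prime[1])
  import Data.Nat.Properties as ℕₚ
  open import Data.Product using (_×_; _,_; proj₁; proj₂; ∃-syntax)
  open import Data.Sum using (_⊎_; inj₁; inj₂)
  open import Relation.Binary.PropositionalEquality
  open import Relation.Nullary using (Dec; yes; no; ¬_)
  open import Relation.Nullary.Decidable using (_×-dec_)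

  open import Defs using (Composition; Comb; coeff; basisMul; mats; readComp; _≈[_]_; one; IsComposition; IsElem; InRad)
    renaming (_*_ to _⊛_; _-_ to _⊝_)
  open Packings using (δ; packings; Positive; ∑-mats-packings-readComp; ∑-mats-δ; ≤ᵇ-true; sum-positives; rowSums-mats)
  open ListSum ℤₚ.+-*-commutativeSemiring
  open ≡-Reasoning

  ∣-zero : ∀ a → a ∣ 0ℤ
  ∣-zero a = divides 0ℤ (sym (ℤₚ.*-zeroˡ a))

  linear : (Composition → ℤ) → Comb → ℤ
  linear g x = ∑[ u ∈ x ] (proj₂ u * g (proj₁ u))

  ∑-pos : {A : Set} (xs : List A) (f : A → ℕ) → ∑[ x ∈ xs ] (+ f x) ≡ + Packings.∑ xs f
  ∑-pos []       f = refl
  ∑-pos (x ∷ xs) f = trans (cong (λ z → + f x + z) (∑-pos xs f)) (sym (ℤₚ.pos-+ (f x) (Packings.∑ xs f)))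

  ∑-neg : {A : Set} (xs : List A) (f : A → ℤ) → ∑[ x ∈ xs ] (- f x) ≡ - ∑ xs f
  ∑-neg xs f = trans (∑-cong xs (λ x → sym (ℤₚ.-1*i≡-i (f x)))) (trans (∑-*ˡ xs -1ℤ f) (ℤₚ.-1*i≡-i (∑ xs f)))

  coeff-linear : ∀ x w → coeff x w ≡ linear (λ q → + δ q w) x
  coeff-linear []            w = refl
  coeff-linear ((q , c) ∷ x) w with ≡-dec ℕ._≟_ q w
  ... | yes _ = cong₂ _+_ (sym (ℤₚ.*-identityʳ c)) (coeff-linear x w)
  ... | no  _ = trans (coeff-linear x w) (sym (trans (cong (_+ linear (λ q → + δ q w) x) (ℤₚ.*-zeroʳ c)) (ℤₚ.+-identityˡ _)))

  coeff-∷-≡ : ∀ q c x → coeff ((q , c) ∷ x) q ≡ c + coeff x q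
  coeff-∷-≡ q c x with ≡-dec ℕ._≟_ q q
  ... | yes _   = refl
  ... | no  q≢q = ⊥-elim (q≢q refl)

  coeff-∷-≢ : ∀ {q w} c x → ¬ q ≡ w → coeff ((q , c) ∷ x) w ≡ coeff x w
  coeff-∷-≢ {q} {w} c x q≢w with ≡-dec ℕ._≟_ q w
  ... | yes q≡w = ⊥-elim (q≢w q≡w)
  ... | no  _   = refl

  linear-⊝ : ∀ g x y → linear g (x ⊝ y) ≡ linear g x - linear g y
  linear-⊝ g x y = trans (∑-++ x _ _) (cong (λ z → linear g x + z) (trans (∑-map _ y _)
    (trans (∑-cong y (λ u → sym (ℤₚ.neg-distribˡ-* (proj₂ u) (g (proj₁ u))))) (∑-neg y _))))

  coeff-⊝ : ∀ x y w → coeff (x ⊝ y) w ≡ coeff x w - coeff y w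
  coeff-⊝ x y w = trans (coeff-linear (x ⊝ y) w)
    (trans (linear-⊝ (λ q → + δ q w) x y) (sym (cong₂ _-_ (coeff-linear x w) (coeff-linear y w))))

  linear-⊛ : ∀ g x y → linear g (x ⊛ y) ≡
    ∑[ s ∈ x ] (proj₂ s * ∑[ t ∈ y ] (proj₂ t * ∑[ Z ∈ mats (proj₁ s) (proj₁ t) ] g (readComp Z)))
  linear-⊛ g x y = trans (∑-concatMap _ x _) (∑-cong x (λ s → trans (∑-concatMap _ y _)
    (trans (∑-cong y (λ t → trans (∑-map _ (basisMul (proj₁ s) (proj₁ t)) _)
                           (trans (∑-map _ (mats (proj₁ s) (proj₁ t)) _)
                             (trans (∑-*ˡ (mats (proj₁ s) (proj₁ t)) (proj₂ s * proj₂ t) _)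
                               (ℤₚ.*-assoc (proj₂ s) (proj₂ t) _)))))
      (∑-*ˡ y (proj₂ s) _))))

  remove : Composition → Comb → Comb
  remove w []            = []
  remove w ((q , c) ∷ z) with ≡-dec ℕ._≟_ q w
  ... | yes _ = remove w z
  ... | no  _ = (q , c) ∷ remove w z

  length-remove : ∀ w z → length (remove w z) ≤ length z
  length-remove w []            = z≤n
  length-remove w ((q , c) ∷ z) with ≡-dec ℕ._≟_ q w
  ... | yes _ = ℕₚ.m≤n⇒m≤1+n (length-remove w z)
  ... | no  _ = s≤s (length-remove w z)

  remove-∷-self : ∀ w c z → remove w ((w , c) ∷ z) ≡ remove w z
  remove-∷-self w c z with ≡-dec ℕ._≟_ w w
  ... | yes _   = refl
  ... | no  w≢w = ⊥-elim (w≢w refl)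

  coeff-remove : ∀ w z {w′} → ¬ w ≡ w′ → coeff (remove w z) w′ ≡ coeff z w′
  coeff-remove w []            w≢w′ = refl
  coeff-remove w ((q , c) ∷ z) {w′} w≢w′ with ≡-dec ℕ._≟_ q w
  ... | yes refl with ≡-dec ℕ._≟_ q w′
  ...   | yes q≡w′ = ⊥-elim (w≢w′ q≡w′)
  ...   | no  _    = coeff-remove w z w≢w′
  coeff-remove w ((q , c) ∷ z) {w′} w≢w′ | no _ with ≡-dec ℕ._≟_ q w′
  ...   | yes _ = cong (λ x → c + x) (coeff-remove w z w≢w′)
  ...   | no  _ = coeff-remove w z w≢w′

  coeff-remove-self : ∀ w z → coeff (remove w z) w ≡ 0ℤ
  coeff-remove-self w []            = refl
  coeff-remove-self w ((q , c) ∷ z) with ≡-dec ℕ._≟_ q w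
  ... | yes _   = coeff-remove-self w z
  ... | no  q≢w = trans (coeff-∷-≢ c (remove w z) q≢w) (coeff-remove-self w z)

  linear-remove : ∀ g w z → linear g z ≡ coeff z w * g w + linear g (remove w z)
  linear-remove g w []            = sym (trans (ℤₚ.+-identityʳ _) (ℤₚ.*-zeroˡ (g w)))
  linear-remove g w ((q , c) ∷ z) with ≡-dec ℕ._≟_ q w
  ... | yes refl = trans (cong (λ x → c * g q + x) (linear-remove g q z)) (regroup c (g q) (coeff z q) _)
    where
    regroup : ∀ a b d e → a * b + (d * b + e) ≡ (a + d) * b + e
    regroup = solve-∀
  ... | no  _    = trans (cong (λ x → c * g q + x) (linear-remove g w z)) (swap c (g q) (coeff z w) (g w) _)
    where
    swap : ∀ a b d f e → a * b + (d * f + e) ≡ d * f + (a * b + e)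
    swap = solve-∀

  ∣-linear : ∀ P g z → (∀ w → P ∣ coeff z w) → P ∣ linear g z
  ∣-linear P g z = bounded (length z) z ℕₚ.≤-refl
    where
    bounded : ∀ n z → length z ≤ n → (∀ w → P ∣ coeff z w) → P ∣ linear g z
    bounded _       []            _           _        = ∣-zero P
    bounded (suc n) ((w , c) ∷ z) (s≤s z≤n′) P∣coeff =
      subst (P ∣_) (sym (linear-remove g w ((w , c) ∷ z)))
        (∣m∣n⇒∣m+n (∣m⇒∣m*n (g w) (P∣coeff w)) (bounded n rest rest≤n P∣rest))
      where
      rest = remove w ((w , c) ∷ z)
      rest≤n : length rest ≤ n
      rest≤n = subst (λ u → length u ≤ n) (sym (remove-∷-self w c z)) (ℕₚ.≤-trans (length-remove w z) z≤n′)
      P∣rest : ∀ w′ → P ∣ coeff rest w′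
      P∣rest w′ with ≡-dec ℕ._≟_ w w′
      ... | yes refl = subst (P ∣_) (sym (coeff-remove-self w ((w , c) ∷ z))) (∣-zero P)
      ... | no  w≢w′ = subst (P ∣_) (sym (coeff-remove w ((w , c) ∷ z) w≢w′)) (P∣coeff w′)

  linear-resp-≈ : ∀ p g x y → x ≈[ p ] y → + p ∣ linear g x - linear g y
  linear-resp-≈ p g x y x≈y = subst (+ p ∣_) (linear-⊝ g x y)
    (∣-linear (+ p) g (x ⊝ y) (λ w → subst (+ p ∣_) (sym (coeff-⊝ x y w)) (∣ᵤ⇒∣ (x≈y w))))

  χ : Composition → Comb → ℤ
  χ q = linear (λ u → + packings q u)

  χ-⊛ : ∀ q → Positive q → ∀ x y → χ q (x ⊛ y) ≡ χ q x * χ q y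
  χ-⊛ q q⁺ x y = begin
      χ q (x ⊛ y)
    ≡⟨ linear-⊛ (λ u → + packings q u) x y ⟩
      ∑[ s ∈ x ] (proj₂ s * ∑[ t ∈ y ] (proj₂ t * ∑[ Z ∈ mats (proj₁ s) (proj₁ t) ] (+ packings q (readComp Z))))
    ≡⟨ ∑-cong x (λ s → cong (proj₂ s *_) (∑-cong y (λ t → cong (proj₂ t *_) (∑-mats-χ (proj₁ s) (proj₁ t))))) ⟩
      ∑[ s ∈ x ] (proj₂ s * ∑[ t ∈ y ] (proj₂ t * (+ packings q (proj₁ s) * + packings q (proj₁ t))))
    ≡⟨ ∑-cong x (λ s → cong (proj₂ s *_) (pull-out (+ packings q (proj₁ s)))) ⟩
      ∑[ s ∈ x ] (proj₂ s * (+ packings q (proj₁ s) * χ q y))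
    ≡⟨ trans (∑-cong x (λ s → sym (ℤₚ.*-assoc (proj₂ s) _ _))) (∑-*ʳ x (χ q y) _) ⟩
      χ q x * χ q y
    ∎
    where
    pull-out : ∀ a → ∑[ t ∈ y ] (proj₂ t * (a * + packings q (proj₁ t))) ≡ a * χ q y
    pull-out a = trans (∑-cong y (λ t → x∙yz≈y∙xz (proj₂ t) a _)) (∑-*ˡ y a _)
    ∑-mats-χ : ∀ s t → ∑[ Z ∈ mats s t ] (+ packings q (readComp Z)) ≡ + packings q s * + packings q t
    ∑-mats-χ s t = trans (∑-pos (mats s t) _)
      (trans (cong +_ (∑-mats-packings-readComp q q⁺ s t)) (ℤₚ.pos-* (packings q s) (packings q t)))

  χ-⊝ : ∀ q x y → χ q (x ⊝ y) ≡ χ q x - χ q y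
  χ-⊝ q = linear-⊝ (λ u → + packings q u)

  χ-resp-≈ : ∀ p q x y → x ≈[ p ] y → + p ∣ χ q x - χ q y
  χ-resp-≈ p q = linear-resp-≈ p (λ u → + packings q u)

  packings-[sum] : ∀ q → packings q (sum q ∷ []) ≡ 1
  packings-[sum] []      = refl
  packings-[sum] (a ∷ q) rewrite ≤ᵇ-true (ℕₚ.m≤m+n a (sum q)) | ℕₚ.m+n∸m≡n a (sum q) =
    trans (ℕₚ.+-identityʳ _) (packings-[sum] q)

  χ-scalar : ∀ q n k → sum q ≡ n → χ q ((n ∷ [] , k) ∷ []) ≡ k
  χ-scalar q _ k refl rewrite packings-[sum] q = trans (ℤₚ.+-identityʳ _) (ℤₚ.*-identityʳ k)

  inverse-mod : ∀ {p} → Prime p → ∀ c → ¬ p ℕ∣.∣ ∣ c ∣ → ∃[ k ] + p ∣ 1ℤ - k * c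
  inverse-mod {p} p-prime c p∤c = adjustSign (ℤₚ.+∣i∣≡i⊎+∣i∣≡-i c) (fromBézout (coprime-Bézout coprime))
    where
    coprime : Coprime p ∣ c ∣
    coprime (d∣p , d∣c) with prime⇒irreducible p-prime d∣p
    ... | inj₁ d≡1 = d≡1
    ... | inj₂ refl = ⊥-elim (p∤c d∣c)
    fromBézout : Bézout.Identity 1 p ∣ c ∣ → ∃[ k ] + p ∣ 1ℤ - k * + ∣ c ∣
    fromBézout (Bézout.+- x y eq) = - + y , divides (+ x) (begin
      1ℤ - - + y * + ∣ c ∣   ≡⟨ lemma (+ y) (+ ∣ c ∣) ⟩
      1ℤ + + y * + ∣ c ∣     ≡⟨ cong (λ z → 1ℤ + z) (ℤₚ.pos-* y ∣ c ∣) ⟨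
      1ℤ + + (y ℕ.* ∣ c ∣)   ≡⟨ ℤₚ.pos-+ 1 (y ℕ.* ∣ c ∣) ⟨
      + (1 ℕ.+ y ℕ.* ∣ c ∣)  ≡⟨ cong +_ eq ⟩
      + (x ℕ.* p)            ≡⟨ ℤₚ.pos-* x p ⟩
      + x * + p              ∎)
      where
      lemma : ∀ a b → 1ℤ - (- a) * b ≡ 1ℤ + a * b
      lemma = solve-∀
    fromBézout (Bézout.-+ x y eq) = + y , divides (- + x) (begin
      1ℤ - + y * + ∣ c ∣       ≡⟨ cong (λ z → 1ℤ - z) (ℤₚ.pos-* y ∣ c ∣) ⟨
      1ℤ - + (y ℕ.* ∣ c ∣)     ≡⟨ cong (λ z → 1ℤ - + z) eq ⟨
      1ℤ - + (1 ℕ.+ x ℕ.* p)   ≡⟨ cong (λ z → 1ℤ - z) (trans (ℤₚ.pos-+ 1 (x ℕ.* p))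
                                                            (cong (λ z → 1ℤ + z) (ℤₚ.pos-* x p))) ⟩
      1ℤ - (1ℤ + + x * + p)    ≡⟨ lemma (+ x) (+ p) ⟩
      - + x * + p              ∎)
      where
      lemma : ∀ a b → 1ℤ - (1ℤ + a * b) ≡ (- a) * b
      lemma = solve-∀
    adjustSign : + ∣ c ∣ ≡ c ⊎ + ∣ c ∣ ≡ - c → ∃[ k ] + p ∣ 1ℤ - k * + ∣ c ∣ → ∃[ k ] + p ∣ 1ℤ - k * c
    adjustSign (inj₁ ∣c∣≡c)  (k , p∣) = k , subst (λ z → + p ∣ 1ℤ - k * z) ∣c∣≡c p∣
    adjustSign (inj₂ ∣c∣≡-c) (k , p∣) =
      - k , subst (+ p ∣_) (trans (cong (λ z → 1ℤ - k * z) ∣c∣≡-c) (lemma k c)) p∣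
      where
      lemma : ∀ a b → 1ℤ - a * (- b) ≡ 1ℤ - (- a) * b
      lemma = solve-∀

  -- If p ∤ c = χ w r, take k with k c ≡ 1 (mod p).  Applying χ w to b (1 − k B_[n] r) ≡ 1
  -- gives χ w b · (1 − k c) ≡ 1, although p divides the left-hand side.
  χ-radical : ∀ {n p} r → Prime p → 1 ≤ n → InRad n p r → ∀ w → IsComposition n w → + p ∣ χ w r
  χ-radical {n} {p} r p-prime 1≤n r∈rad w (w⁺ , sum≡n) with p ℕ∣.∣? ∣ χ w r ∣
  ... | yes p∣c = ∣ᵤ⇒∣ p∣c
  ... | no  p∤c = ⊥-elim (¬prime[1] (subst Prime (ℕ∣.∣1⇒≡1 (∣⇒∣ᵤ p∣1)) p-prime))
    where
    c k : ℤ
    c = χ w r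
    k = proj₁ (inverse-mod p-prime c p∤c)
    a b : Comb
    a = (n ∷ [] , k) ∷ []
    a∈Zₙ : IsElem n a
    a∈Zₙ = ((1≤n ∷ []) , ℕₚ.+-identityʳ n) ∷ []
    b = proj₁ (r∈rad a a∈Zₙ)
    χ-one : χ w (one n) ≡ 1ℤ
    χ-one = χ-scalar w n 1ℤ sum≡n
    χ-unit : χ w (b ⊛ (one n ⊝ (a ⊛ r))) ≡ χ w b * (1ℤ - k * c)
    χ-unit = trans (χ-⊛ w w⁺ b (one n ⊝ (a ⊛ r))) (cong (χ w b *_) (trans (χ-⊝ w (one n) (a ⊛ r))
               (cong₂ _-_ χ-one (trans (χ-⊛ w w⁺ a r) (cong (_* c) (χ-scalar w n k sum≡n))))))
    p∣unit-1 : + p ∣ χ w b * (1ℤ - k * c) - 1ℤ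
    p∣unit-1 = subst (+ p ∣_) (cong₂ _-_ χ-unit χ-one)
                 (χ-resp-≈ p w (b ⊛ (one n ⊝ (a ⊛ r))) (one n) (proj₂ (proj₂ (r∈rad a a∈Zₙ))))
    p∣1 : + p ∣ 1ℤ
    p∣1 = subst (+ p ∣_) (lemma (χ w b * (1ℤ - k * c)))
            (∣m∣n⇒∣m-n (∣n⇒∣m*n (χ w b) (proj₂ (inverse-mod p-prime c p∤c))) p∣unit-1)
      where
      lemma : ∀ z → z - (z - 1ℤ) ≡ 1ℤ
      lemma = solve-∀

  sum-concat : ∀ Z → sum (concat Z) ≡ sum (map sum Z)
  sum-concat []      = refl
  sum-concat (v ∷ Z) = trans (sum-++ v (concat Z)) (cong (sum v ℕ.+_) (sum-concat Z))

  readComp-composition : ∀ {n s Z} → sum s ≡ n → map sum Z ≡ s → IsComposition n (readComp Z)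
  readComp-composition {Z = Z} sum≡n rows≡ = all-filter (1 ℕₚ.≤?_) (concat Z) ,
    trans (sum-positives (concat Z)) (trans (sum-concat Z) (trans (cong sum rows≡) sum≡n))

  ⊛-closed : ∀ {n x y} → IsElem n x → IsElem n y → IsElem n (x ⊛ y)
  ⊛-closed x∈ y∈ = concat⁺ (map⁺ (All.map (λ {s} s∈ → concat⁺ (map⁺ (All.map (λ {t} _ →
    map⁺ (map⁺ (All.map (readComp-composition (proj₂ s∈)) (rowSums-mats (proj₁ s) (proj₁ t))))) y∈))) x∈))

  coeff-nonComposition : ∀ {n x w} → IsElem n x → ¬ IsComposition n w → coeff x w ≡ 0ℤ
  coeff-nonComposition {x = []}            _           _  = refl
  coeff-nonComposition {x = (q , c) ∷ x} {w} (q∈ ∷ x∈) w∉ with ≡-dec ℕ._≟_ q w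
  ... | yes refl = ⊥-elim (w∉ q∈)
  ... | no  _    = coeff-nonComposition x∈ w∉

  isComposition? : ∀ n w → Dec (IsComposition n w)
  isComposition? n w = All.all? (1 ℕₚ.≤?_) w ×-dec (sum w ℕ.≟ n)

  coeffIn-⊛ : Comb → Composition → Composition → ℤ
  coeffIn-⊛ r w s = ∑[ t ∈ r ] (proj₂ t * ∑[ Z ∈ mats s (proj₁ t) ] (+ δ (readComp Z) w))

  coeff-⊛ : ∀ x r w → coeff (x ⊛ r) w ≡ linear (coeffIn-⊛ r w) x
  coeff-⊛ x r w = trans (coeff-linear (x ⊛ r) w) (linear-⊛ (λ q → + δ q w) x r)

  coeffIn-⊛-long : ∀ r w s → Positive s → length w ≤ length s → coeffIn-⊛ r w s ≡ + δ s w * χ w r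
  coeffIn-⊛-long r w s s⁺ w≤s = begin
      ∑[ t ∈ r ] (proj₂ t * ∑[ Z ∈ mats s (proj₁ t) ] (+ δ (readComp Z) w))
    ≡⟨ ∑-cong r (λ t → cong (proj₂ t *_) (count (proj₁ t))) ⟩
      ∑[ t ∈ r ] (proj₂ t * (+ δ s w * + packings s (proj₁ t)))
    ≡⟨ trans (∑-cong r (λ t → x∙yz≈y∙xz (proj₂ t) (+ δ s w) _)) (∑-*ˡ r (+ δ s w) _) ⟩
      + δ s w * χ s r
    ≡⟨ onlyDiagonal ⟩
      + δ s w * χ w r
    ∎
    where
    count : ∀ t → ∑[ Z ∈ mats s t ] (+ δ (readComp Z) w) ≡ + δ s w * + packings s t
    count t = trans (∑-pos (mats s t) _) (trans (cong +_ (∑-mats-δ s s⁺ t w w≤s)) (ℤₚ.pos-* (δ s w) (packings s t)))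
    onlyDiagonal : + δ s w * χ s r ≡ + δ s w * χ w r
    onlyDiagonal with ≡-dec ℕ._≟_ s w
    ... | yes refl = refl
    ... | no  _    = refl

  linear-coeffIn-⊛ : ∀ {n m} r w y′ → length w ≤ m →
    All (λ t → IsComposition n (proj₁ t) × m ≤ length (proj₁ t)) y′ →
    linear (coeffIn-⊛ r w) y′ ≡ coeff y′ w * χ w r
  linear-coeffIn-⊛ {n} {m} r w y′ w≤m y′-long = begin
    ∑[ u ∈ y′ ] (proj₂ u * coeffIn-⊛ r w (proj₁ u))  ≡⟨ ∑-congᴬ (All.map (λ {u} → long {u}) y′-long) ⟩
    ∑[ u ∈ y′ ] (proj₂ u * + δ (proj₁ u) w * χ w r)  ≡⟨ ∑-*ʳ y′ (χ w r) _ ⟩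
    linear (λ q → + δ q w) y′ * χ w r                ≡⟨ cong (_* χ w r) (coeff-linear y′ w) ⟨
    coeff y′ w * χ w r                               ∎
    where
    long : ∀ {u} → IsComposition n (proj₁ u) × m ≤ length (proj₁ u) →
           proj₂ u * coeffIn-⊛ r w (proj₁ u) ≡ proj₂ u * + δ (proj₁ u) w * χ w r
    long {u} ((s⁺ , _) , m≤s) =
      trans (cong (proj₂ u *_) (coeffIn-⊛-long r w (proj₁ u) s⁺ (ℕₚ.≤-trans w≤m m≤s)))
            (sym (ℤₚ.*-assoc (proj₂ u) _ _))

  p∣coeff-⊛-short : ∀ {n p m y′} y r w → length w ≤ m →
    All (λ t → IsComposition n (proj₁ t) × m ≤ length (proj₁ t)) y′ → y ≈[ p ] y′ →
    (∀ w → IsComposition n w → + p ∣ χ w r) → + p ∣ coeff (y ⊛ r) w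
  p∣coeff-⊛-short {n} {p} {m} {y′} y r w w≤m y′-long y≈y′ p∣χ =
    subst (+ p ∣_) (trans (regroup (linear G y) (linear G y′)) (sym (coeff-⊛ y r w)))
      (∣m∣n⇒∣m+n (linear-resp-≈ p G y y′ y≈y′) p∣linear-y′)
    where
    G : Composition → ℤ
    G = coeffIn-⊛ r w
    regroup : ∀ a b → (a - b) + b ≡ a
    regroup = solve-∀
    p∣y′w : + p ∣ coeff y′ w * χ w r
    p∣y′w with isComposition? n w
    ... | yes w∈ = ∣n⇒∣m*n (coeff y′ w) (p∣χ w w∈)
    ... | no  w∉ = subst (+ p ∣_) (sym (cong (_* χ w r) (coeff-nonComposition (All.map proj₁ y′-long) w∉)))
                     (∣-zero (+ p))
    p∣linear-y′ : + p ∣ linear G y′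
    p∣linear-y′ = subst (+ p ∣_) (sym (linear-coeffIn-⊛ r w y′ w≤m y′-long)) p∣y′w

  dropShort : ℕ → Comb → Comb
  dropShort m = filter (λ u → m ℕₚ.<? length (proj₁ u))

  coeff-dropShort : ∀ m x w → coeff (dropShort m x) w ≡ (if m <ᵇ length w then coeff x w else 0ℤ)
  coeff-dropShort m []            w = sym (if-eta (m <ᵇ length w))
  coeff-dropShort m ((q , c) ∷ x) w with ≡-dec ℕ._≟_ q w
  coeff-dropShort m ((q , c) ∷ x) w | yes refl with m <ᵇ length q in long
  ... | true  = trans (coeff-∷-≡ q c (dropShort m x))
                  (cong (λ z → c + z) (trans (coeff-dropShort m x q) (if-cong long)))
  ... | false = trans (coeff-dropShort m x q) (if-cong long)
  coeff-dropShort m ((q , c) ∷ x) w | no q≢w with m <ᵇ length q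
  ... | true  = trans (coeff-∷-≢ c (dropShort m x) q≢w) (coeff-dropShort m x w)
  ... | false = coeff-dropShort m x w

  dropShort-long : ∀ {n} m x → IsElem n x →
    All (λ t → IsComposition n (proj₁ t) × suc m ≤ length (proj₁ t)) (dropShort m x)
  dropShort-long m x x∈ = All.zip (filter⁺ (λ u → m ℕₚ.<? length (proj₁ u)) x∈ , all-filter _ x)

  ≈-dropShort : ∀ {p} m x → (∀ w → length w ≤ m → + p ∣ coeff x w) → x ≈[ p ] dropShort m x
  ≈-dropShort {p} m x p∣short w = ∣⇒∣ᵤ (subst (λ z → + p ∣ coeff x w - z) (sym (coeff-dropShort m x w)) p∣diff)
    where
    p∣diff : + p ∣ coeff x w - (if m <ᵇ length w then coeff x w else 0ℤ)
    p∣diff with m <ᵇ length w in long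
    ... | true  = subst (+ p ∣_) (sym (ℤₚ.+-inverseʳ (coeff x w))) (∣-zero (+ p))
    ... | false = subst (+ p ∣_) (sym (ℤₚ.+-identityʳ (coeff x w)))
                    (p∣short w (ℕₚ.≮⇒≥ (λ m<w → subst T long (ℕₚ.<⇒<ᵇ m<w))))

open import Defs
open import Data.Nat using (ℕ; suc; _≤_)
open import Data.Product using (_,_)

mainTheorem9 : (n p m : ℕ) → 1 ≤ n → Prime p → 1 ≤ m →
    (y r : Comb) → IsElem n y → IsElem n r →
    InY n p m y → InRad n p r → InY n p (suc m) (y * r)
-- The argument works for every m.
mainTheorem9 n p m 1≤n p-prime _ y r y∈ r∈ (y′ , y′-long , y≈y′) r∈rad =
  dropShort m (y * r) , dropShort-long m (y * r) (⊛-closed y∈ r∈) , ≈-dropShort m (y * r)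
    (λ w w≤m → p∣coeff-⊛-short y r w w≤m y′-long y≈y′ (χ-radical r p-prime 1≤n r∈rad))
  where open Characters
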